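{- Let $b,r$ be positive integers with $3\le b<r\le\binom{b+1}{2}-1$, and let $x_0=\left\lceil b-\frac{1+\sqrt{1+8(r-b)}}{2}\right\rceil-1$. Then $$2(r+x_0)(b+1-x_0)=\min\left\{2(r+x)(b+1-x)\ :\ x\in\mathbb{Z},\ 0\le x\le b,\ x+\binom{b+1-x}{2}>r\right\}.$$ -}

module Defs where

open import Data.Nat as ℕ using (ℕ)
open import Data.Nat.Combinatorics using (_C_)
open import Data.Integer using (ℤ; +_; _+_; _-_; _*_; _≤_; _<_; ∣_∣)
open import Data.Sum using (_⊎_)
open import Data.Product using (_×_)

-- Let s = √(1 + 8(r - b)) (a real number ≥ 0).  For an integer c,
--   c = ⌈ b - (1 + s)/2 ⌉
-- means  c - 1 < b - (1+s)/2 ≤ c , i.e.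
--   (i)  2(b - c) - 1 ≤ s      and   (ii)  s < 2(b - c) + 1 .
-- Since s ≥ 0, with D = 1 + 8(r - b) ≥ 0 and s = √D these are, exactly:
--   (i)  2(b-c)-1 ≤ 0  or  (2(b-c)-1)² ≤ D
--   (ii) 0 < 2(b-c)+1  and  D < (2(b-c)+1)²
disc : ℤ → ℤ → ℤ
disc b r = + 1 + + 8 * (r - b)

IsCeilBMinusHalf1PlusSqrt : ℤ → ℤ → ℤ → Set
IsCeilBMinusHalf1PlusSqrt b r c =
  ((+ 2 * (b - c) - + 1 ≤ + 0) ⊎
   ((+ 2 * (b - c) - + 1) * (+ 2 * (b - c) - + 1) ≤ disc b r))
  × (+ 0 < + 2 * (b - c) + + 1)
  × (disc b r < (+ 2 * (b - c) + + 1) * (+ 2 * (b - c) + + 1))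

IsX0 : ℤ → ℤ → ℤ → Set
IsX0 b r x₀ = IsCeilBMinusHalf1PlusSqrt b r (x₀ + + 1)

choose2 : ℤ → ℤ
choose2 n = + (∣ n ∣ C 2)

obj : ℤ → ℤ → ℤ → ℤ
obj b r x = + 2 * (r + x) * (b + + 1 - x)

Admissible : ℤ → ℤ → ℤ → Set
Admissible b r x = (+ 0 ≤ x) × (x ≤ b) × (r < x + choose2 (b + + 1 - x))

{-# OPTIONS --safe #-}
-- Write r = b + d and let T(n) = C(n+1, 2) = 0 + 1 + ⋯ + n.  Since (2k+1)² = 1 + 8·T(k), the
-- ceiling condition defining x₀ says exactly that x₀ = b − k − 1 for the least k with d < T(k).
-- For x = b − n the constraint x + C(b+1−x, 2) > r reads n + d < T(n), i.e. d < T(n − 1), so the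
-- admissible x are exactly 0 ≤ x ≤ x₀.  The objective is decreasing there, because
--   obj x − obj y = 2 (y − x) (x + y + r − b − 1) ≥ 0   for 0 ≤ x ≤ y and b < r,
-- so its minimum over the admissible set is attained at x₀.
module Submission where

open import Defs
open import Data.Integer
  using (ℤ; +_; -[1+_]; -_; _+_; _-_; _*_; _≤_; _<_; +≤+; +<+; nonNegative)
import Data.Integer.Properties as ℤ
open import Data.Integer.Tactic.RingSolver using (solve-∀)
open import Data.Nat as ℕ using (ℕ; zero; suc; z≤n; s≤s)
import Data.Nat.Properties as ℕ
import Data.Nat.Tactic.RingSolver as ℕ-Solver
open import Data.Nat.Combinatorics using (_C_; nCk+nC[k+1]≡[n+1]C[k+1]; nC1≡n)
open import Data.Product using (_×_; _,_; proj₁; proj₂; ∃-syntax)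
open import Data.Sum using (_⊎_; inj₁; inj₂)
open import Function.Bundles using (_⇔_; mk⇔; Equivalence)
open import Relation.Nullary using (contradiction)
open import Relation.Binary.PropositionalEquality
  using (_≡_; refl; sym; trans; cong; cong₂; subst; module ≡-Reasoning)

triangle : ℕ → ℕ
triangle zero    = 0
triangle (suc n) = suc n ℕ.+ triangle n

sucC2≡triangle : ∀ n → suc n C 2 ≡ triangle n
sucC2≡triangle zero    = refl
sucC2≡triangle (suc n) = begin
  suc (suc n) C 2           ≡⟨ sym (nCk+nC[k+1]≡[n+1]C[k+1] (suc n) 1) ⟩
  suc n C 1 ℕ.+ suc n C 2   ≡⟨ cong₂ ℕ._+_ (nC1≡n (suc n)) (sucC2≡triangle n) ⟩
  suc n ℕ.+ triangle n      ∎
  where open ≡-Reasoning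

2*triangle≡n*[1+n] : ∀ n → 2 ℕ.* triangle n ≡ n ℕ.* suc n
2*triangle≡n*[1+n] zero    = refl
2*triangle≡n*[1+n] (suc n) = begin
  2 ℕ.* (suc n ℕ.+ triangle n)         ≡⟨ ℕ.*-distribˡ-+ 2 (suc n) (triangle n) ⟩
  2 ℕ.* suc n ℕ.+ 2 ℕ.* triangle n     ≡⟨ cong (2 ℕ.* suc n ℕ.+_) (2*triangle≡n*[1+n] n) ⟩
  2 ℕ.* suc n ℕ.+ n ℕ.* suc n          ≡⟨ sym (ℕ.*-distribʳ-+ (suc n) 2 n) ⟩
  suc (suc n) ℕ.* suc n                ≡⟨ ℕ.*-comm (suc (suc n)) (suc n) ⟩
  suc n ℕ.* suc (suc n)                ∎
  where open ≡-Reasoning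

triangle-mono-≤ : ∀ {m n} → m ℕ.≤ n → triangle m ℕ.≤ triangle n
triangle-mono-≤ z≤n       = z≤n
triangle-mono-≤ (s≤s m≤n) = ℕ.+-mono-≤ (s≤s m≤n) (triangle-mono-≤ m≤n)

triangle-cancel-< : ∀ {m n} → triangle m ℕ.< triangle n → m ℕ.< n
triangle-cancel-< Tm<Tn = ℕ.≰⇒> λ n≤m → ℕ.<⇒≱ Tm<Tn (triangle-mono-≤ n≤m)

odd-square : ∀ n → suc (2 ℕ.* n) ℕ.* suc (2 ℕ.* n) ≡ 1 ℕ.+ 8 ℕ.* triangle n
odd-square n = begin
  suc (2 ℕ.* n) ℕ.* suc (2 ℕ.* n)   ≡⟨ expand n ⟩
  1 ℕ.+ 4 ℕ.* (n ℕ.* suc n)         ≡⟨ cong (λ z → 1 ℕ.+ 4 ℕ.* z) (sym (2*triangle≡n*[1+n] n)) ⟩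
  1 ℕ.+ 4 ℕ.* (2 ℕ.* triangle n)    ≡⟨ cong (1 ℕ.+_) (sym (ℕ.*-assoc 4 2 (triangle n))) ⟩
  1 ℕ.+ 8 ℕ.* triangle n            ∎
  where
  open ≡-Reasoning
  expand : ∀ n → suc (2 ℕ.* n) ℕ.* suc (2 ℕ.* n) ≡ 1 ℕ.+ 4 ℕ.* (n ℕ.* suc n)
  expand = ℕ-Solver.solve-∀

+2*n+1≡+[1+2*n] : ∀ n → + 2 * + n + + 1 ≡ + suc (2 ℕ.* n)
+2*n+1≡+[1+2*n] n = begin
  + 2 * + n + + 1     ≡⟨ cong (_+ + 1) (sym (ℤ.pos-* 2 n)) ⟩
  + (2 ℕ.* n ℕ.+ 1)   ≡⟨ cong +_ (ℕ.+-comm (2 ℕ.* n) 1) ⟩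
  + suc (2 ℕ.* n)     ∎
  where open ≡-Reasoning

odd-square-ℤ : ∀ n → (+ 2 * + n + + 1) * (+ 2 * + n + + 1) ≡ + (1 ℕ.+ 8 ℕ.* triangle n)
odd-square-ℤ n = begin
  (+ 2 * + n + + 1) * (+ 2 * + n + + 1)  ≡⟨ cong (λ z → z * z) (+2*n+1≡+[1+2*n] n) ⟩
  + suc (2 ℕ.* n) * + suc (2 ℕ.* n)      ≡⟨ sym (ℤ.pos-* (suc (2 ℕ.* n)) (suc (2 ℕ.* n))) ⟩
  + (suc (2 ℕ.* n) ℕ.* suc (2 ℕ.* n))    ≡⟨ cong +_ (odd-square n) ⟩
  + (1 ℕ.+ 8 ℕ.* triangle n)             ∎
  where open ≡-Reasoning

1+8*-cancel-< : ∀ {m n} → + (1 ℕ.+ 8 ℕ.* m) < + (1 ℕ.+ 8 ℕ.* n) → m ℕ.< n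
1+8*-cancel-< {m} {n} (+<+ (s≤s 8m<8n)) = ℕ.*-cancelˡ-< 8 m n 8m<8n

1+8*-cancel-≤ : ∀ {m n} → + (1 ℕ.+ 8 ℕ.* m) ≤ + (1 ℕ.+ 8 ℕ.* n) → m ℕ.≤ n
1+8*-cancel-≤ (+≤+ (s≤s 8m≤8n)) = ℕ.*-cancelˡ-≤ 8 8m≤8n

LeastTriangleAbove : ℕ → ℕ → Set
LeastTriangleAbove d k = d ℕ.< triangle k × (∀ {m} → d ℕ.< triangle m → k ℕ.≤ m)

disc≡1+8*d : ∀ b d → disc (+ b) (+ (b ℕ.+ d)) ≡ + (1 ℕ.+ 8 ℕ.* d)
disc≡1+8*d b d = begin
  + 1 + + 8 * (+ (b ℕ.+ d) - + b)  ≡⟨ cong (λ z → + 1 + + 8 * (z - + b)) (ℤ.pos-+ b d) ⟩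
  + 1 + + 8 * (+ b + + d - + b)    ≡⟨ cancel (+ b) (+ d) ⟩
  + 1 + + 8 * + d                  ≡⟨ cong (_+_ (+ 1)) (sym (ℤ.pos-* 8 d)) ⟩
  + (1 ℕ.+ 8 ℕ.* d)                ∎
  where
  open ≡-Reasoning
  cancel : ∀ b d → + 1 + + 8 * (b + d - b) ≡ + 1 + + 8 * d
  cancel = solve-∀

2[1+j]-1≡2j+1 : ∀ j → + 2 * (+ 1 + j) - + 1 ≡ + 2 * j + + 1
2[1+j]-1≡2j+1 = solve-∀

ceiling-lower-bound⇒minimal : ∀ d k →
  (+ 2 * + k - + 1 ≤ + 0) ⊎ ((+ 2 * + k - + 1) * (+ 2 * + k - + 1) ≤ + (1 ℕ.+ 8 ℕ.* d)) →
  ∀ {m} → d ℕ.< triangle m → k ℕ.≤ m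
ceiling-lower-bound⇒minimal d zero    _ _ = z≤n
ceiling-lower-bound⇒minimal d (suc j) (inj₁ 2k-1≤0) _ =
  contradiction (subst (_≤ + 0) (trans (2[1+j]-1≡2j+1 (+ j)) (+2*n+1≡+[1+2*n] j)) 2k-1≤0) λ { (+≤+ ()) }
ceiling-lower-bound⇒minimal d (suc j) (inj₂ [2k-1]²≤D) d<Tm =
  triangle-cancel-< (ℕ.≤-<-trans Tj≤d d<Tm)
  where
  Tj≤d : triangle j ℕ.≤ d
  Tj≤d = 1+8*-cancel-≤ (subst (_≤ _) (trans (cong (λ z → z * z) (2[1+j]-1≡2j+1 (+ j))) (odd-square-ℤ j)) [2k-1]²≤D)

ceiling⇒leastTriangleAbove : ∀ {r} b d c → b ℕ.+ d ≡ r → IsCeilBMinusHalf1PlusSqrt (+ b) (+ r) c →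
  ∃[ k ] (+ b - c ≡ + k × LeastTriangleAbove d k)
ceiling⇒leastTriangleAbove b d c refl (lower , positive , upper) =
  decode (disc≡1+8*d b d) lower positive upper
  where
  decode : ∀ {D t} → D ≡ + (1 ℕ.+ 8 ℕ.* d) →
    (+ 2 * t - + 1 ≤ + 0) ⊎ ((+ 2 * t - + 1) * (+ 2 * t - + 1) ≤ D) →
    + 0 < + 2 * t + + 1 → D < (+ 2 * t + + 1) * (+ 2 * t + + 1) →
    ∃[ k ] (t ≡ + k × LeastTriangleAbove d k)
  decode {t = -[1+ n ]} _ _ 0<2t+1 _ = contradiction (subst (+ 0 <_) 2t+1≡-[1+2n] 0<2t+1) λ ()
    where
    2t+1≡-[1+2n] : + 2 * -[1+ n ] + + 1 ≡ -[1+ 2 ℕ.* n ]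
    2t+1≡-[1+2n] = trans (negate (+ n)) (cong (λ z → - (+ 1 + z)) (sym (ℤ.pos-* 2 n)))
      where
      negate : ∀ t → + 2 * - (+ 1 + t) + + 1 ≡ - (+ 1 + + 2 * t)
      negate = solve-∀
  decode {t = + k} refl lower _ upper =
    k , refl , 1+8*-cancel-< (subst (_ <_) (odd-square-ℤ k) upper) , ceiling-lower-bound⇒minimal d k lower

n+d<triangle⇒k<n : ∀ {d k n} → LeastTriangleAbove d k → n ℕ.+ d ℕ.< triangle n → k ℕ.< n
n+d<triangle⇒k<n {n = zero}  _              ()
n+d<triangle⇒k<n {n = suc m} (_ , minimal) n+d<Tn = s≤s (minimal (ℕ.+-cancelˡ-< (suc m) _ _ n+d<Tn))

r≤[2+b]C2∸1⇒k≤b : ∀ {b d k} → suc b ℕ.+ d ℕ.≤ suc (suc b) C 2 ℕ.∸ 1 → LeastTriangleAbove d k → k ℕ.≤ b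
r≤[2+b]C2∸1⇒k≤b {b} {d} r≤ (_ , minimal) =
  minimal (ℕ.+-cancelˡ-< b d (triangle b) (subst (λ z → suc b ℕ.+ d ℕ.≤ z ℕ.∸ 1) (sucC2≡triangle (suc b)) r≤))

choose2-complement : ∀ i n → choose2 (+ (i ℕ.+ n) + + 1 - + i) ≡ + triangle n
choose2-complement i n = begin
  choose2 (+ (i ℕ.+ n) + + 1 - + i)  ≡⟨ cong (λ z → choose2 (z + + 1 - + i)) (ℤ.pos-+ i n) ⟩
  choose2 (+ i + + n + + 1 - + i)    ≡⟨ cong choose2 (cancel (+ i) (+ n)) ⟩
  + (suc n C 2)                      ≡⟨ cong +_ (sucC2≡triangle n) ⟩
  + triangle n                       ∎
  where
  open ≡-Reasoning
  cancel : ∀ i n → i + n + + 1 - i ≡ + 1 + n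
  cancel = solve-∀

admissible⇔ : ∀ {b r} i n d → i ℕ.+ n ≡ b → b ℕ.+ d ≡ r →
  Admissible (+ b) (+ r) (+ i) ⇔ n ℕ.+ d ℕ.< triangle n
admissible⇔ i n d refl refl = mk⇔ to from
  where
  b r : ℕ
  b = i ℕ.+ n
  r = b ℕ.+ d
  count≡ : + i + choose2 (+ b + + 1 - + i) ≡ + (i ℕ.+ triangle n)
  count≡ = cong (_+_ (+ i)) (choose2-complement i n)
  r≡ : i ℕ.+ (n ℕ.+ d) ≡ r
  r≡ = sym (ℕ.+-assoc i n d)
  to : Admissible (+ b) (+ r) (+ i) → n ℕ.+ d ℕ.< triangle n
  to (_ , _ , r<count) =
    ℕ.+-cancelˡ-< i _ _ (subst (ℕ._< i ℕ.+ triangle n) (sym r≡) (ℤ.drop‿+<+ (subst (+ r <_) count≡ r<count)))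
  from : n ℕ.+ d ℕ.< triangle n → Admissible (+ b) (+ r) (+ i)
  from n+d<Tn = +≤+ z≤n , +≤+ (ℕ.m≤m+n i n) ,
    subst (+ r <_) (sym count≡) (+<+ (subst (ℕ._< i ℕ.+ triangle n) r≡ (ℕ.+-monoʳ-< i n+d<Tn)))

*-nonNeg : ∀ {i j} → + 0 ≤ i → + 0 ≤ j → + 0 ≤ i * j
*-nonNeg {+ m} {+ n} _ _ = subst (+ 0 ≤_) (ℤ.pos-* m n) (+≤+ z≤n)

obj-antitone : ∀ {b r x y} → b < r → + 0 ≤ x → x ≤ y → obj b r y ≤ obj b r x
obj-antitone {b} {r} {x} {y} b<r 0≤x x≤y =
  subst (obj b r y ≤_) (sym (obj-difference b r x y)) (ℤ.i≤i+j (obj b r y) _ {{nonNegative 0≤gap}})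
  where
  obj-difference : ∀ b r x y →
    + 2 * (r + x) * (b + + 1 - x) ≡ + 2 * (r + y) * (b + + 1 - y) + + 2 * (y - x) * (x + y + (r - (+ 1 + b)))
  obj-difference = solve-∀
  0≤gap : + 0 ≤ + 2 * (y - x) * (x + y + (r - (+ 1 + b)))
  0≤gap = *-nonNeg (*-nonNeg {+ 2} (+≤+ z≤n) (ℤ.i≤j⇒0≤j-i x≤y))
    (ℤ.+-mono-≤ (ℤ.+-mono-≤ 0≤x (ℤ.≤-trans 0≤x x≤y)) (ℤ.i≤j⇒0≤j-i (ℤ.i<j⇒suc[i]≤j b<r)))

b-[x+1]≡k⇒x≡e : ∀ {b k e} x → + b - (x + + 1) ≡ + k → e ℕ.+ suc k ≡ b → x ≡ + e
b-[x+1]≡k⇒x≡e {k = k} {e} x b-[x+1]≡k refl = begin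
  x                                             ≡⟨ regroup (+ b) x ⟩
  + b - (+ b - (x + + 1)) - + 1                 ≡⟨ cong (λ z → + b - z - + 1) b-[x+1]≡k ⟩
  + b - + k - + 1                               ≡⟨ cong (λ z → z - + k - + 1) (ℤ.pos-+ e (suc k)) ⟩
  + e + (+ 1 + + k) - + k - + 1                 ≡⟨ cancel (+ e) (+ k) ⟩
  + e                                           ∎
  where
  open ≡-Reasoning
  b : ℕ
  b = e ℕ.+ suc k
  regroup : ∀ b x → x ≡ b - (b - (x + + 1)) - + 1
  regroup = solve-∀
  cancel : ∀ e k → e + (+ 1 + k) - k - + 1 ≡ e
  cancel = solve-∀

admissible[b-k-1] : ∀ {b r d k e} → LeastTriangleAbove d k → e ℕ.+ suc k ≡ b → b ℕ.+ d ≡ r →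
  Admissible (+ b) (+ r) (+ e)
admissible[b-k-1] {d = d} {k} {e} (d<Tk , _) e+[1+k]≡b b+d≡r =
  Equivalence.from (admissible⇔ e (suc k) d e+[1+k]≡b b+d≡r) (ℕ.+-monoʳ-< (suc k) d<Tk)

admissible⇒≤b-k-1 : ∀ {b r d k e x} → LeastTriangleAbove d k → e ℕ.+ suc k ≡ b → b ℕ.+ d ≡ r →
  Admissible (+ b) (+ r) x → x ≤ + e
admissible⇒≤b-k-1 {b} {d = d} {k} {e} least e+[1+k]≡b b+d≡r adm@(+≤+ {n = i} _ , +≤+ i≤b , _) = +≤+ i≤e
  where
  n : ℕ
  n = b ℕ.∸ i
  i+n≡b : i ℕ.+ n ≡ b
  i+n≡b = ℕ.m+[n∸m]≡n i≤b
  k<n : k ℕ.< n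
  k<n = n+d<triangle⇒k<n least (Equivalence.to (admissible⇔ i n d i+n≡b b+d≡r) adm)
  i≤e : i ℕ.≤ e
  i≤e = ℕ.+-cancelʳ-≤ (suc k) i e (begin
    i ℕ.+ suc k  ≤⟨ ℕ.+-monoʳ-≤ i k<n ⟩
    i ℕ.+ n      ≡⟨ i+n≡b ⟩
    b            ≡⟨ sym e+[1+k]≡b ⟩
    e ℕ.+ suc k  ∎)
    where open ℕ.≤-Reasoning

lemma3p5 : (b r : ℕ) → 3 ℕ.≤ b → b ℕ.< r → r ℕ.≤ (ℕ.suc b C 2) ℕ.∸ 1 →
    (x₀ : ℤ) → IsX0 (+ b) (+ r) x₀ →
    (∃[ x ] (Admissible (+ b) (+ r) x × obj (+ b) (+ r) x ≡ obj (+ b) (+ r) x₀))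
    × (∀ x → Admissible (+ b) (+ r) x → obj (+ b) (+ r) x₀ ≤ obj (+ b) (+ r) x)
lemma3p5 b@(suc b') r (s≤s _) b<r r≤T x₀ isX0 =
  (x₀ , subst (Admissible (+ b) (+ r)) (sym x₀≡e) (admissible[b-k-1] least e+[1+k]≡b b+d≡r) , refl) ,
  λ x adm → obj-antitone (+<+ b<r) (proj₁ adm)
              (subst (x ≤_) (sym x₀≡e) (admissible⇒≤b-k-1 least e+[1+k]≡b b+d≡r adm))
  where
  d : ℕ
  d = r ℕ.∸ b
  b+d≡r : b ℕ.+ d ≡ r
  b+d≡r = ℕ.m+[n∸m]≡n (ℕ.<⇒≤ b<r)
  decoded : ∃[ k ] (+ b - (x₀ + + 1) ≡ + k × LeastTriangleAbove d k)
  decoded = ceiling⇒leastTriangleAbove b d (x₀ + + 1) b+d≡r isX0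
  k : ℕ
  k = proj₁ decoded
  least : LeastTriangleAbove d k
  least = proj₂ (proj₂ decoded)
  e : ℕ
  e = b' ℕ.∸ k
  e+[1+k]≡b : e ℕ.+ suc k ≡ b
  e+[1+k]≡b = trans (ℕ.+-suc e k)
    (cong suc (ℕ.m∸n+n≡m (r≤[2+b]C2∸1⇒k≤b (subst (ℕ._≤ suc b C 2 ℕ.∸ 1) (sym b+d≡r) r≤T) least)))
  x₀≡e : x₀ ≡ + e
  x₀≡e = b-[x+1]≡k⇒x≡e x₀ (proj₁ (proj₂ decoded)) e+[1+k]≡b
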